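{- Let $n\ge 5$ and $0<j,k<n/2$ be integers with $\gcd(k,j)=1$, such that the $I$-graph $I(n,k,j)$ is connected. Then the cop number of $I(n,k,j)$ is at most $5$.
   Context: The $I$-graph $I(n,k,j)$ (with $n\ge 5$, $0<j,k<n/2$) has vertex set $\{a_0,\dots,a_{n-1}\}\cup\{b_0,\dots,b_{n-1}\}$ and edges $(a_i,a_{i+j})$, $(a_i,b_i)$, $(b_i,b_{i+k})$ for each $i$, indices read modulo $n$. The cop number of a graph is the least number $m$ of cops that can guarantee capture of a single robber in finitely many moves in the standard game of cops and robbers (alternating turns, cops first, each pawn moves to an adjacent vertex or stays, capture when a cop and the robber share a vertex, complete information). -}

module Defs where

open import Data.Nat using (ℕ; zero; suc; _+_; _≤_)
open import Data.Nat.DivMod using (_%_)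
open import Data.Fin using (Fin; toℕ)
open import Data.Bool using (Bool; true; false)
open import Data.Product using (Σ; ∃; _×_; _,_)
open import Data.Sum using (_⊎_)
open import Data.Empty using (⊥)
open import Relation.Binary.PropositionalEquality using (_≡_)
open import Relation.Binary.Construct.Closure.ReflexiveTransitive using (Star)

Connected : {V : Set} → (V → V → Set) → Set
Connected {V} Adj = (u v : V) → Star Adj u v

Step : {V : Set} → (V → V → Set) → V → V → Set
Step Adj u v = (u ≡ v) ⊎ Adj u v

CopsStep : {V : Set} → (V → V → Set) → {m : ℕ} → (Fin m → V) → (Fin m → V) → Set
CopsStep Adj {m} C C' = (i : Fin m) → Step Adj (C i) (C' i)

-- Win Adj C r : it is the robber's turn, cops are at C, robber at r, and the
-- cops can force capture in finitely many moves (inductive = well-founded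
-- game tree, hence finite play).
data Win {V : Set} (Adj : V → V → Set) {m : ℕ} : (Fin m → V) → V → Set where
  caught : ∀ {C r} → (i : Fin m) → C i ≡ r → Win Adj C r
  step   : ∀ {C r} →
           ((r' : V) → Step Adj r r' →
              Σ (Fin m → V) (λ C' → CopsStep Adj C C' × Win Adj C' r')) →
           Win Adj C r

-- m cops have a winning strategy: cops choose initial positions, then the
-- robber chooses his position, then the cops move first, and play alternates.
CopsWin : {V : Set} → (V → V → Set) → ℕ → Set
CopsWin {V} Adj m =
  Σ (Fin m → V) λ C₀ → (r₀ : V) →
    Σ (Fin m → V) λ C₁ → CopsStep Adj C₀ C₁ × Win Adj C₁ r₀

CopNumber≤ : {V : Set} → (V → V → Set) → ℕ → Set
CopNumber≤ Adj c = ∃ λ m → m ≤ c × CopsWin Adj m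

-- I-graphs I(n,k,j).  Vertex (true , i) = a_i,  (false , i) = b_i.

IVertex : ℕ → Set
IVertex n = Bool × Fin n

IEdge : (n k j : ℕ) → IVertex n → IVertex n → Set
IEdge zero    k j _ _ = ⊥
IEdge (suc m) k j (true  , i) (true  , i') = toℕ i' ≡ (toℕ i + j) % suc m
IEdge (suc m) k j (true  , i) (false , i') = i ≡ i'
IEdge (suc m) k j (false , i) (true  , i') = ⊥
IEdge (suc m) k j (false , i) (false , i') = toℕ i' ≡ (toℕ i + k) % suc m

IAdj : (n k j : ℕ) → IVertex n → IVertex n → Set
IAdj n k j u v = IEdge n k j u v ⊎ IEdge n k j v u

-- Two pairs of cops act as guards, one for each layer, and a fifth cop catches the robber on
-- the spokes.  A pair guarding layer H (stride g) keeps c⁺ + (a+1) g ≡ x ≡ c⁻ − (b+1) g (mod n)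
-- for the robber's index x: when the robber moves inside H both cops close in, so a + b drops,
-- and when he moves in the other layer they copy his move there.  Once both layers are guarded,
-- every move inside a layer shrinks one guard's measure without increasing the other's, so
-- eventually the robber only crosses spokes, while the fifth cop walks to him along a fixed path.
-- To install the guards, write every index as c + e j + a k (Bézout, gcd(k, j) = 1).  Two
-- co-located pairs squeeze the coordinate e from both sides; the first to reach it guards layer b,
-- and the other pair then walks along layer b to the robber's k-coordinate and guards layer a.
module Submission where

open import Data.Bool using (Bool; true; false; not)
open import Data.Bool.Properties using (not-¬)
open import Data.Empty using (⊥-elim)
open import Data.Fin as Fin using (Fin; toℕ; #_)
open import Data.Fin.Permutation using (Permutation′; _⟨$⟩ʳ_; _⟨$⟩ˡ_; inverseʳ; transpose; _∘ₚ_)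
open import Data.Fin.Properties using (toℕ-fromℕ<; toℕ<n; toℕ-injective)
open import Data.List using ([]; _∷_)
open import Data.Nat using (ℕ; zero; suc; pred; _+_; _*_; _≤_; _<_; z≤n; s≤s; s≤s⁻¹)
open import Data.Nat.DivMod using (_%_; _mod_; m%n<n; m%n%n≡m%n; [m+kn]%n≡m%n; %-distribˡ-+; m<n⇒m%n≡m)
open import Data.Nat.GCD using (gcd; gcd-GCD; module Bézout)
open import Data.Nat.Properties
open import Data.Nat.Tactic.RingSolver using (solve)
open import Data.Product using (Σ; ∃₂; _×_; _,_; proj₁; proj₂)
open import Data.Sum using (inj₁; inj₂)
open import Data.Vec as Vec using (Vec; lookup; _[_]≔_)
open import Data.Vec.Properties using (lookup∘update; lookup∘update′)
open import Data.Vec.Relation.Binary.Pointwise.Inductive as Pointwise using (Pointwise)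
open import Level using (0ℓ)
open import Relation.Binary using (Setoid)
import Relation.Binary.Reasoning.Setoid as SetoidReasoning
open import Relation.Binary.Construct.Closure.ReflexiveTransitive using (Star; ε; _◅_)
open import Relation.Binary.PropositionalEquality
open import Relation.Nullary using (yes; no; contradiction)

open import Defs

open Bézout using (Identity; +-; -+)

suc+suc-injective : ∀ {a b c d} → suc a + suc b ≡ suc c + suc d → a + b ≡ c + d
suc+suc-injective {a} {b} {c} {d} eq = suc-injective (begin
  suc (a + b)   ≡⟨ +-suc a b ⟨
  a + suc b     ≡⟨ suc-injective eq ⟩
  c + suc d     ≡⟨ +-suc c d ⟩
  suc (c + d)   ∎)
  where open ≡-Reasoning

squeeze-< : ∀ {a b c d} → suc (suc a) + suc (suc b) ≡ suc c + suc d → a + b < c + d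
squeeze-< {a} {b} eq = subst (a + b <_) (suc+suc-injective {suc a} {suc b} eq) (s≤s (+-monoʳ-≤ a (n≤1+n b)))

module Game {V : Set} (Adj : V → V → Set) where

  record Respond {m} (cs : Vec V m) (r' : V) : Set where
    constructor respond
    field
      next : Fin m → V
      moves : CopsStep Adj (lookup cs) next
      wins : Win Adj next r'

  Win-respond : ∀ {m} {cs : Vec V m} {r} → (∀ r' → Step Adj r r' → Respond cs r') → Win Adj (lookup cs) r
  Win-respond answer = step λ r' s → let respond C' moves win = answer r' s in C' , moves , win

  five : V → V → V → V → V → Vec V 5
  five a b c d e = a Vec.∷ b Vec.∷ c Vec.∷ d Vec.∷ e Vec.∷ Vec.[]

  move5 : ∀ {a b c d e a' b' c' d' e' r'} →
          Step Adj a a' → Step Adj b b' → Step Adj c c' → Step Adj d d' → Step Adj e e' →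
          Win Adj (lookup (five a' b' c' d' e')) r' → Respond (five a b c d e) r'
  move5 {a} {b} {c} {d} {e} {a'} {b'} {c'} {d'} {e'} sa sb sc sd se win =
    respond (lookup (five a' b' c' d' e')) (Pointwise.lookup moves) win
    where
    moves : Pointwise (Step Adj) (five a b c d e) (five a' b' c' d' e')
    moves = sa Pointwise.∷ sb Pointwise.∷ sc Pointwise.∷ sd Pointwise.∷ se Pointwise.∷ Pointwise.[]

  catch : ∀ {m} {cs : Vec V m} {r'} (i : Fin m) → Step Adj (lookup cs i) r' → Respond cs r'
  catch {cs = cs} {r'} i s = respond (lookup (cs [ i ]≔ r')) move (caught i (lookup∘update i cs r'))
    where
    move : CopsStep Adj (lookup cs) (lookup (cs [ i ]≔ r'))
    move l with l Fin.≟ i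
    ... | yes refl = subst (Step Adj (lookup cs i)) (sym (lookup∘update i cs r')) s
    ... | no l≢i = subst (Step Adj (lookup cs l)) (sym (lookup∘update′ l≢i cs r')) (inj₁ refl)

  Win-permute : ∀ {m} (π : Permutation′ m) {C D : Fin m → V} {r} →
                (∀ i → D i ≡ C (π ⟨$⟩ʳ i)) → Win Adj C r → Win Adj D r
  Win-permute π {C} D≡Cπ (caught i Ci≡r) =
    caught (π ⟨$⟩ˡ i) (trans (D≡Cπ _) (trans (cong C (inverseʳ π)) Ci≡r))
  Win-permute {m} π {C} {D} D≡Cπ (step answer) = step λ r' s → relabel (answer r' s)
    where
    relabel : ∀ {r'} → Σ (Fin m → V) (λ C' → CopsStep Adj C C' × Win Adj C' r') →
                      Σ (Fin m → V) (λ C' → CopsStep Adj D C' × Win Adj C' r')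
    relabel (C' , move , win) =
      (λ i → C' (π ⟨$⟩ʳ i)) ,
      (λ i → subst (λ v → Step Adj v (C' (π ⟨$⟩ʳ i))) (sym (D≡Cπ i)) (move (π ⟨$⟩ʳ i))) ,
      Win-permute π (λ _ → refl) win

  swap-pairs : ∀ {a b c d e r} → Win Adj (lookup (five a b c d e)) r → Win Adj (lookup (five c d a b e)) r
  swap-pairs = Win-permute (transpose (# 0) (# 2) ∘ₚ transpose (# 1) (# 3)) λ
    { Fin.zero → refl
    ; (Fin.suc Fin.zero) → refl
    ; (Fin.suc (Fin.suc Fin.zero)) → refl
    ; (Fin.suc (Fin.suc (Fin.suc Fin.zero))) → refl
    ; (Fin.suc (Fin.suc (Fin.suc (Fin.suc Fin.zero)))) → refl
    }

module Modular (m : ℕ) where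

  n : ℕ
  n = suc m

  infix 4 _≋_
  record _≋_ (u v : ℕ) : Set where
    constructor mod-≡
    field %-≡ : u % n ≡ v % n

  ≋-refl : ∀ {u} → u ≋ u
  ≋-refl = mod-≡ refl

  ≋-sym : ∀ {u v} → u ≋ v → v ≋ u
  ≋-sym (mod-≡ e) = mod-≡ (sym e)

  ≋-trans : ∀ {u v w} → u ≋ v → v ≋ w → u ≋ w
  ≋-trans (mod-≡ e) (mod-≡ f) = mod-≡ (trans e f)

  ≋-setoid : Setoid 0ℓ 0ℓ
  ≋-setoid = record
    { Carrier = ℕ ; _≈_ = _≋_
    ; isEquivalence = record { refl = ≋-refl ; sym = ≋-sym ; trans = ≋-trans } }

  module ≋-Reasoning = SetoidReasoning ≋-setoid

  ≡⇒≋ : ∀ {u v} → u ≡ v → u ≋ v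
  ≡⇒≋ refl = ≋-refl

  +-cong : ∀ {a b c d} → a ≋ b → c ≋ d → a + c ≋ b + d
  +-cong {a} {b} {c} {d} (mod-≡ a≡b) (mod-≡ c≡d) = mod-≡ (begin
    (a + c) % n           ≡⟨ %-distribˡ-+ a c n ⟩
    (a % n + c % n) % n   ≡⟨ cong₂ (λ u v → (u + v) % n) a≡b c≡d ⟩
    (b % n + d % n) % n   ≡⟨ %-distribˡ-+ b d n ⟨
    (b + d) % n           ∎)
    where open ≡-Reasoning

  +-congˡ : ∀ a {c d} → c ≋ d → a + c ≋ a + d
  +-congˡ a = +-cong (≋-refl {a})

  +-congʳ : ∀ {a b} c → a ≋ b → a + c ≋ b + c
  +-congʳ c a≋b = +-cong a≋b (≋-refl {c})

  -- y + m * y is n * y, written so that ring normalisation applies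
  absorb : ∀ a y → a + (y + m * y) ≋ a
  absorb a y = ≋-trans (≡⇒≋ (cong (a +_) (*-comm n y))) (mod-≡ ([m+kn]%n≡m%n a y n))

  +-cancelʳ : ∀ {u v} w → u + w ≋ v + w → u ≋ v
  +-cancelʳ {u} {v} w eq = begin
    u                 ≈⟨ absorb u w ⟨
    u + (w + m * w)   ≡⟨ +-assoc u w (m * w) ⟨
    u + w + m * w     ≈⟨ +-congʳ (m * w) eq ⟩
    v + w + m * w     ≡⟨ +-assoc v w (m * w) ⟩
    v + (w + m * w)   ≈⟨ absorb v w ⟩
    v                 ∎
    where open ≋-Reasoning

  -- m is −1 modulo n
  neg : ℕ → ℕ
  neg h = m * h

  +-neg : ∀ h → h + neg h ≋ 0
  +-neg h = absorb 0 h

  neg-involutive : ∀ y → neg (neg y) ≋ y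
  neg-involutive y = +-cancelʳ (neg y) (begin
    neg (neg y) + neg y   ≡⟨ +-comm (neg (neg y)) (neg y) ⟩
    neg y + neg (neg y)   ≈⟨ +-neg (neg y) ⟩
    0                     ≈⟨ +-neg y ⟨
    y + neg y             ∎)
    where open ≋-Reasoning

  +≋⇒≋+neg : ∀ {a b} h → a + h ≋ b → a ≋ b + neg h
  +≋⇒≋+neg {a} {b} h eq = begin
    a                 ≡⟨ +-identityʳ a ⟨
    a + 0             ≈⟨ +-congˡ a (+-neg h) ⟨
    a + (h + neg h)   ≡⟨ +-assoc a h (neg h) ⟨
    a + h + neg h     ≈⟨ +-congʳ (neg h) eq ⟩
    b + neg h         ∎
    where open ≋-Reasoning

  ≋+⇒+neg≋ : ∀ {a b} h → a ≋ b + h → a + neg h ≋ b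
  ≋+⇒+neg≋ {a} {b} h eq = begin
    a + neg h         ≈⟨ +-congʳ (neg h) eq ⟩
    b + h + neg h     ≡⟨ +-assoc b h (neg h) ⟩
    b + (h + neg h)   ≈⟨ +-congˡ b (+-neg h) ⟩
    b + 0             ≡⟨ +-identityʳ b ⟩
    b                 ∎
    where open ≋-Reasoning

  toℕ-mod : ∀ u → toℕ (u mod n) ≋ u
  toℕ-mod u = mod-≡ (trans (cong (_% n) (toℕ-fromℕ< (m%n<n u n))) (m%n%n≡m%n u n))

  toℕ-% : ∀ (i : Fin n) → toℕ i % n ≡ toℕ i
  toℕ-% i = m<n⇒m%n≡m (toℕ<n i)

  ≋⇒≡ : ∀ {i i' : Fin n} → toℕ i ≋ toℕ i' → i ≡ i'
  ≋⇒≡ {i} {i'} (mod-≡ e) = toℕ-injective (trans (sym (toℕ-% i)) (trans e (toℕ-% i')))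

  advance : Fin n → ℕ → Fin n
  advance c h = (toℕ c + h) mod n

  advance-neg : ∀ c h → toℕ (advance c (neg h)) + h ≋ toℕ c
  advance-neg c h = begin
    toℕ (advance c (neg h)) + h               ≈⟨ +-congˡ _ (neg-involutive h) ⟨
    toℕ (advance c (neg h)) + neg (neg h)     ≈⟨ ≋+⇒+neg≋ (neg h) (toℕ-mod (toℕ c + neg h)) ⟩
    toℕ c                                     ∎
    where open ≋-Reasoning

  data Slide (h x x' : ℕ) : Set where
    still : x' ≋ x → Slide h x x'
    fwd   : x' ≋ x + h → Slide h x x'
    bwd   : x' + h ≋ x → Slide h x x'

  Slide-flip : ∀ {h x x'} → Slide h x x' → Slide (neg h) x x'
  Slide-flip (still eq) = still eq
  Slide-flip {h} (fwd eq) = bwd (≋+⇒+neg≋ h eq)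
  Slide-flip {h} (bwd eq) = fwd (+≋⇒≋+neg h eq)

  shift : ∀ {h x x'} → Slide h x x' → ℕ
  shift (still _) = 0
  shift (fwd _) = 1
  shift (bwd _) = m

  slide-≋ : ∀ {h x x'} (μ : Slide h x x') → x' ≋ x + shift μ * h
  slide-≋ {h} {x} (still eq) = ≋-trans eq (≡⇒≋ (sym (+-identityʳ x)))
  slide-≋ {h} {x} (fwd eq) = ≋-trans eq (≡⇒≋ (cong (x +_) (sym (*-identityˡ h))))
  slide-≋ {h} (bwd eq) = +≋⇒≋+neg h eq

  -- a gap of e + 1 steps becomes after μ e steps when the robber slides by μ
  after : ∀ {h x x'} → Slide h x x' → ℕ → ℕ
  after (still _) e = suc e
  after (fwd _) e = suc (suc e)
  after (bwd _) e = e

  after-flip : ∀ {h x x'} (μ : Slide h x x') a b → after μ a + after (Slide-flip μ) b ≡ suc a + suc b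
  after-flip (still _) a b = refl
  after-flip (fwd _) a b = sym (+-suc (suc a) b)
  after-flip (bwd _) a b = +-suc a (suc b)

  after≤ : ∀ {h x x'} (μ : Slide h x x') e → after μ e ≤ suc (suc e)
  after≤ (still _) e = n≤1+n (suc e)
  after≤ (fwd _) e = ≤-refl
  after≤ (bwd _) e = ≤-trans (n≤1+n e) (n≤1+n (suc e))

  record Gap (h c e w x : ℕ) : Set where
    constructor gap
    field gap-≋ : c + e * h + w ≋ x

  gap-transport : ∀ {h c e w x h' c' e' w' x'} → Gap h c e w x →
                  c' + e' * h' + w' + x ≋ c + e * h + w + x' → Gap h' c' e' w' x'
  gap-transport {h} {c} {e} {w} {x} {h'} {c'} {e'} {w'} {x'} (gap G) eq = gap (+-cancelʳ x (begin
    c' + e' * h' + w' + x   ≈⟨ eq ⟩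
    c + e * h + w + x'      ≈⟨ +-congʳ x' G ⟩
    x + x'                  ≡⟨ +-comm x x' ⟩
    x' + x                  ∎))
    where open ≋-Reasoning

  gap-arrived : ∀ {h c w x} → Gap h c 0 w x → c + w ≋ x
  gap-arrived {c = c} {w} (gap G) = ≋-trans (≡⇒≋ (cong (_+ w) (sym (+-identityʳ c)))) G

  caught-at : ∀ {h} {c x : Fin n} → Gap h (toℕ c) 0 0 (toℕ x) → c ≡ x
  caught-at G = ≋⇒≡ (≋-trans (≡⇒≋ (sym (+-identityʳ _))) (gap-arrived G))

  gap-slide : ∀ {h c e w x x'} (μ : Slide h x x') → Gap h c (suc e) w x → Gap h c (after μ e) w x'
  gap-slide (still eq) (gap G) = gap (≋-trans G (≋-sym eq))
  gap-slide {h} {c} {e} {w} {x} {x'} (fwd eq) G = gap-transport G (begin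
    c + suc (suc e) * h + w + x   ≡⟨ solve (c ∷ e ∷ h ∷ w ∷ x ∷ []) ⟩
    c + suc e * h + w + (x + h)   ≈⟨ +-congˡ _ eq ⟨
    c + suc e * h + w + x'        ∎)
    where open ≋-Reasoning
  gap-slide {h} {c} {e} {w} {x} {x'} (bwd eq) G = gap-transport G (begin
    c + e * h + w + x             ≈⟨ +-congˡ _ eq ⟨
    c + e * h + w + (x' + h)      ≡⟨ solve (c ∷ e ∷ h ∷ w ∷ x' ∷ []) ⟩
    c + suc e * h + w + x'        ∎)
    where open ≋-Reasoning

  gap-chase : ∀ {h c c' e w x} → c' ≋ c + h → Gap h c (suc e) w x → Gap h c' e w x
  gap-chase {h} {c} {c'} {e} {w} {x} eq G = gap-transport G (begin
    c' + e * h + w + x            ≈⟨ +-congʳ x (+-congʳ w (+-congʳ (e * h) eq)) ⟩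
    c + h + e * h + w + x         ≡⟨ solve (c ∷ h ∷ e ∷ w ∷ x ∷ []) ⟩
    c + suc e * h + w + x         ∎)
    where open ≋-Reasoning

  gap-advance : ∀ {h c e w x} → Gap h (toℕ c) (suc e) w x → Gap h (toℕ (advance c h)) e w x
  gap-advance = gap-chase (toℕ-mod _)

  gap-translate : ∀ {h c c' e w x x' q} → c' ≋ c + q → x' ≋ x + q → Gap h c e w x → Gap h c' e w x'
  gap-translate {h} {c} {c'} {e} {w} {x} {x'} {q} c'≋ x'≋ G = gap-transport G (begin
    c' + e * h + w + x            ≈⟨ +-congʳ x (+-congʳ w (+-congʳ (e * h) c'≋)) ⟩
    c + q + e * h + w + x         ≡⟨ solve (c ∷ q ∷ e ∷ h ∷ w ∷ x ∷ []) ⟩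
    c + e * h + w + (x + q)       ≈⟨ +-congˡ _ x'≋ ⟨
    c + e * h + w + x'            ∎)
    where open ≋-Reasoning

  shadow : ∀ {h x x'} → Slide h x x' → Fin n → Fin n
  shadow {h} μ c = advance c (shift μ * h)

  gap-shadow : ∀ {h h' c e w x x'} (μ : Slide h x x') → Gap h' (toℕ c) e w x →
               Gap h' (toℕ (shadow μ c)) e w x'
  gap-shadow μ = gap-translate (toℕ-mod _) (slide-≋ μ)

  shadow-slide : ∀ {h x x'} (μ : Slide h x x') c → Slide h (toℕ c) (toℕ (shadow μ c))
  shadow-slide {h} (still _) c = still (≋-trans (toℕ-mod _) (≡⇒≋ (+-identityʳ (toℕ c))))
  shadow-slide {h} (fwd _) c = fwd (≋-trans (toℕ-mod _) (≡⇒≋ (cong (toℕ c +_) (*-identityˡ h))))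
  shadow-slide {h} (bwd _) c = bwd (advance-neg c h)

  gap-reweigh : ∀ {h c e a s q x x'} → x' ≋ x + q * s → Gap h c e (a * s) x → Gap h c e ((a + q) * s) x'
  gap-reweigh {h} {c} {e} {a} {s} {q} {x} {x'} x'≋ G = gap-transport G (begin
    c + e * h + (a + q) * s + x     ≡⟨ solve (c ∷ e ∷ h ∷ a ∷ q ∷ s ∷ x ∷ []) ⟩
    c + e * h + a * s + (x + q * s) ≈⟨ +-congˡ _ x'≋ ⟨
    c + e * h + a * s + x'          ∎)
    where open ≋-Reasoning

  gap-drift : ∀ {s h c e a x x'} (μ : Slide s x x') → Gap h c e (a * s) x →
              Σ ℕ λ a' → Gap h c e (a' * s) x'
  gap-drift {a = a} μ G = a + shift μ , gap-reweigh {a = a} {q = shift μ} (slide-≋ μ) G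

  gap-wrap : ∀ {h c e w x} → Gap h c e w x → Gap h c (n + e) w x
  gap-wrap {h} {c} {e} {w} {x} G = gap-transport G (begin
    c + (h + (m + e) * h) + w + x         ≡⟨ solve (c ∷ h ∷ m ∷ e ∷ w ∷ x ∷ []) ⟩
    c + e * h + w + x + (h + m * h)       ≈⟨ absorb _ h ⟩
    c + e * h + w + x                     ∎)
    where open ≋-Reasoning

  gap-reverse : ∀ {h c e w x} → Gap h c e w x → Gap (neg h) c (neg e) w x
  gap-reverse {h} {c} {e} {w} {x} G = gap-transport G (begin
    c + m * e * (m * h) + w + x   ≡⟨ solve (c ∷ m ∷ e ∷ h ∷ w ∷ x ∷ []) ⟩
    c + w + x + m * (m * (e * h)) ≈⟨ +-congˡ _ (neg-involutive (e * h)) ⟩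
    c + w + x + e * h             ≡⟨ solve (c ∷ w ∷ x ∷ e ∷ h ∷ []) ⟩
    c + e * h + w + x             ∎)
    where open ≋-Reasoning

  gap-split : ∀ {c a s x} → c + a * s ≋ x →
              ∃₂ λ A B → Gap s c (suc A) 0 x × Gap (neg s) c (suc B) 0 x
  gap-split {c} {a} {s} {x} eq = m + a , m + m * a , gap ahead , gap behind
    where
    open ≋-Reasoning
    ahead : c + suc (m + a) * s + 0 ≋ x
    ahead = begin
      c + suc (m + a) * s + 0     ≡⟨ solve (c ∷ m ∷ a ∷ s ∷ []) ⟩
      c + a * s + (s + m * s)     ≈⟨ absorb _ s ⟩
      c + a * s                   ≈⟨ eq ⟩
      x                           ∎
    behind : c + suc (m + m * a) * (m * s) + 0 ≋ x
    behind = begin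
      c + suc (m + m * a) * (m * s) + 0           ≡⟨ solve (c ∷ m ∷ a ∷ s ∷ []) ⟩
      c + m * (m * (a * s)) + (m * s + m * (m * s)) ≈⟨ absorb _ (m * s) ⟩
      c + m * (m * (a * s))                       ≈⟨ +-congˡ c (neg-involutive (a * s)) ⟩
      c + a * s                                   ≈⟨ eq ⟩
      x                                           ∎

  bezout-difference : ∀ {s h} → Identity 1 s h → ∀ c d {x} → c + d ≋ x →
                      ∃₂ λ e a → Gap h c e (a * s) x
  bezout-difference {s} {h} (+- X Y eq) c d {x} c+d≋x = m * (d * Y) , d * X , gap (begin
    c + m * (d * Y) * h + d * X * s           ≡⟨ cong (c + m * (d * Y) * h +_) dXs ⟩
    c + m * (d * Y) * h + d * (1 + Y * h)     ≡⟨ solve (c ∷ m ∷ d ∷ Y ∷ h ∷ []) ⟩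
    c + d + (d * Y * h + m * (d * Y * h))     ≈⟨ absorb _ (d * Y * h) ⟩
    c + d                                     ≈⟨ c+d≋x ⟩
    x                                         ∎)
    where
    open ≋-Reasoning
    dXs : d * X * s ≡ d * (1 + Y * h)
    dXs = trans (*-assoc d X s) (cong (d *_) (sym eq))
  bezout-difference {s} {h} (-+ X Y eq) c d {x} c+d≋x = d * Y , m * (d * X) , gap (begin
    c + d * Y * h + m * (d * X) * s           ≡⟨ cong (λ t → c + t + m * (d * X) * s) dYh ⟩
    c + d * (1 + X * s) + m * (d * X) * s     ≡⟨ solve (c ∷ m ∷ d ∷ X ∷ s ∷ []) ⟩
    c + d + (d * X * s + m * (d * X * s))     ≈⟨ absorb _ (d * X * s) ⟩
    c + d                                     ≈⟨ c+d≋x ⟩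
    x                                         ∎)
    where
    open ≋-Reasoning
    dYh : d * Y * h ≡ d * (1 + X * s)
    dYh = trans (*-assoc d Y h) (cong (d *_) (sym eq))

  bezout-gap : ∀ {s h} → Identity 1 s h → ∀ c x → ∃₂ λ e a → Gap h c e (a * s) x
  bezout-gap id c x = bezout-difference id c (x + m * c) (begin
    c + (x + m * c)   ≡⟨ solve (c ∷ x ∷ m ∷ []) ⟩
    x + (c + m * c)   ≈⟨ absorb x c ⟩
    x                 ∎)
    where open ≋-Reasoning

module IGraph (m k j : ℕ) where

  open Modular m public

  V : Set
  V = IVertex n

  Adj : V → V → Set
  Adj = IAdj n k j

  open Game Adj

  stay : ∀ {v} → Step Adj v v
  stay = inj₁ refl

  stride : Bool → ℕ
  stride true = j
  stride false = k

  along : ∀ b {c c' : Fin n} → toℕ c' ≋ toℕ c + stride b → IEdge n k j (b , c) (b , c')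
  along true {c' = c'} (mod-≡ e) = trans (sym (toℕ-% c')) e
  along false {c' = c'} (mod-≡ e) = trans (sym (toℕ-% c')) e

  slide-step : ∀ b {c c'} → Slide (stride b) (toℕ c) (toℕ c') → Step Adj (b , c) (b , c')
  slide-step b (still eq) = inj₁ (cong (b ,_) (sym (≋⇒≡ eq)))
  slide-step b (fwd eq) = inj₂ (inj₁ (along b eq))
  slide-step b (bwd eq) = inj₂ (inj₂ (along b (≋-sym eq)))

  forward : ∀ b c → Step Adj (b , c) (b , advance c (stride b))
  forward b c = slide-step b (fwd (toℕ-mod _))

  backward : ∀ b c → Step Adj (b , c) (b , advance c (neg (stride b)))
  backward b c = slide-step b (bwd (advance-neg c (stride b)))

  across : ∀ b c → Step Adj (b , c) (not b , c)
  across true c = inj₂ (inj₁ refl)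
  across false c = inj₂ (inj₂ refl)

  across⁻¹ : ∀ b c → Step Adj (not b , c) (b , c)
  across⁻¹ true c = inj₂ (inj₂ refl)
  across⁻¹ false c = inj₂ (inj₁ refl)

  onto : ∀ {u b h} {c x : Fin n} → Step Adj u (b , c) → Gap h (toℕ c) 0 0 (toℕ x) → Step Adj u (b , x)
  onto {u} {b} s G = subst (λ v → Step Adj u (b , v)) (caught-at G) s

  data Move : V → V → Set where
    slide : ∀ {b x x'} → Slide (stride b) (toℕ x) (toℕ x') → Move (b , x) (b , x')
    cross : ∀ {b x} → Move (b , x) (not b , x)

  edge-≋ : ∀ (x x' : Fin n) h → toℕ x' ≡ (toℕ x + h) % n → toℕ x' ≋ toℕ x + h
  edge-≋ x _ h e = mod-≡ (trans (cong (_% n) e) (m%n%n≡m%n (toℕ x + h) n))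

  decode : ∀ {r r'} → Step Adj r r' → Move r r'
  decode (inj₁ refl) = slide (still ≋-refl)
  decode {true , x} {true , x'} (inj₂ (inj₁ e)) = slide (fwd (edge-≋ x x' j e))
  decode {true , x} {true , x'} (inj₂ (inj₂ e)) = slide (bwd (≋-sym (edge-≋ x' x j e)))
  decode {false , x} {false , x'} (inj₂ (inj₁ e)) = slide (fwd (edge-≋ x x' k e))
  decode {false , x} {false , x'} (inj₂ (inj₂ e)) = slide (bwd (≋-sym (edge-≋ x' x k e)))
  decode {true , _} {false , _} (inj₂ (inj₁ refl)) = cross
  decode {false , _} {true , _} (inj₂ (inj₂ refl)) = cross

  data Side : Set where
    onH onO : Side

  module Guard (H : Bool) where

    O : Bool
    O = not H

    g : ℕ
    g = stride H

    layer : Side → Bool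
    layer onH = H
    layer onO = O

    -- While the robber is in O the cops shadow him there.  debt pays for the move the cops
    -- lose when the robber is in H while they are still in O.
    record State (r : V) : Set where
      constructor state
      field
        side : Side
        c⁺ c⁻ : Fin n
        a b debt : ℕ
        gap⁺ : Gap g (toℕ c⁺) (suc a) 0 (toℕ (proj₂ r))
        gap⁻ : Gap (neg g) (toℕ c⁻) (suc b) 0 (toℕ (proj₂ r))
        follows : proj₁ r ≡ O → side ≡ onO
        indebted : side ≡ onO → proj₁ r ≡ H → 1 ≤ debt

    measure : ∀ {r} → State r → ℕ
    measure p = State.a p + State.b p + State.debt p

    cop⁺ cop⁻ : ∀ {r} → State r → V
    cop⁺ p = layer (State.side p) , State.c⁺ p
    cop⁻ p = layer (State.side p) , State.c⁻ p

    inH : ∀ {x} c⁺ c⁻ a b → Gap g (toℕ c⁺) (suc a) 0 (toℕ x) →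
          Gap (neg g) (toℕ c⁻) (suc b) 0 (toℕ x) → State (H , x)
    inH c⁺ c⁻ a b G⁺ G⁻ = state onH c⁺ c⁻ a b 0 G⁺ G⁻ (λ H≡O → ⊥-elim (not-¬ refl H≡O)) λ ()

    inO : ∀ {x} c⁺ c⁻ a b → Gap g (toℕ c⁺) (suc a) 0 (toℕ x) →
          Gap (neg g) (toℕ c⁻) (suc b) 0 (toℕ x) → State (O , x)
    inO c⁺ c⁻ a b G⁺ G⁻ =
      state onO c⁺ c⁻ a b 0 G⁺ G⁻ (λ _ → refl) (λ _ O≡H → ⊥-elim (not-¬ refl (sym O≡H)))

    enter : ∀ {r} (c : Fin n) a → toℕ c + a * g ≋ toℕ (proj₂ r) → State r
    enter c a eq with gap-split {a = a} eq
    ... | A , B , G⁺ , G⁻ = state onO c c A B 1 G⁺ G⁻ (λ _ → refl) (λ _ _ → ≤-refl)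

    data Outcome {r} (p : State r) (r' : V) (_⊏_ : ℕ → ℕ → Set) : Set where
      capture⁺ : Step Adj (cop⁺ p) r' → Outcome p r' _⊏_
      capture⁻ : Step Adj (cop⁻ p) r' → Outcome p r' _⊏_
      continue : (p' : State r') → Step Adj (cop⁺ p) (cop⁺ p') → Step Adj (cop⁻ p) (cop⁻ p') →
                 measure p' ⊏ measure p → Outcome p r' _⊏_

    close-in : ∀ {x x'} (p : State (H , x)) {t⁺ t⁻} →
               Gap g (toℕ (State.c⁺ p)) t⁺ 0 (toℕ x') →
               Gap (neg g) (toℕ (State.c⁻ p)) t⁻ 0 (toℕ x') →
               t⁺ + t⁻ ≡ suc (State.a p) + suc (State.b p) → Outcome p (H , x') _<_
    close-in (state onO _ _ _ _ zero _ _ _ indebted) _ _ _ = contradiction (indebted refl refl) λ ()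
    close-in (state onO c⁺ _ _ _ (suc _) _ _ _ _) {zero} G⁺ _ _ = capture⁺ (onto (across⁻¹ H c⁺) G⁺)
    close-in (state onO _ c⁻ _ _ (suc _) _ _ _ _) {suc _} {zero} _ G⁻ _ =
      capture⁻ (onto (across⁻¹ H c⁻) G⁻)
    close-in (state onO c⁺ c⁻ _ _ (suc _) _ _ _ _) {suc a'} {suc b'} G⁺ G⁻ sum =
      continue (inH c⁺ c⁻ a' b' G⁺ G⁻) (across⁻¹ H c⁺) (across⁻¹ H c⁻)
        (+-mono-≤-< (≤-reflexive (suc+suc-injective sum)) (s≤s z≤n))
    close-in (state onH _ _ _ _ _ _ _ _ _) {zero} G⁺ _ _ = capture⁺ (onto stay G⁺)
    close-in (state onH c⁺ _ _ _ _ _ _ _ _) {suc zero} G⁺ _ _ =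
      capture⁺ (onto (forward H c⁺) (gap-advance G⁺))
    close-in (state onH _ _ _ _ _ _ _ _ _) {suc (suc _)} {zero} _ G⁻ _ = capture⁻ (onto stay G⁻)
    close-in (state onH _ c⁻ _ _ _ _ _ _ _) {suc (suc _)} {suc zero} _ G⁻ _ =
      capture⁻ (onto (backward H c⁻) (gap-advance G⁻))
    close-in (state onH c⁺ c⁻ _ _ _ _ _ _ _) {suc (suc a')} {suc (suc b')} G⁺ G⁻ sum =
      continue (inH (advance c⁺ g) (advance c⁻ (neg g)) a' b' (gap-advance G⁺) (gap-advance G⁻))
        (forward H c⁺) (backward H c⁻) (+-mono-<-≤ (squeeze-< sum) z≤n)

    respond-own : ∀ {x x'} (p : State (H , x)) → Slide g (toℕ x) (toℕ x') → Outcome p (H , x') _<_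
    respond-own p μ = close-in p (gap-slide μ (State.gap⁺ p)) (gap-slide (Slide-flip μ) (State.gap⁻ p))
                        (after-flip μ (State.a p) (State.b p))

    respond-other : ∀ {x x'} (p : State (O , x)) → Slide (stride O) (toℕ x) (toℕ x') →
                    Outcome p (O , x') _≤_
    respond-other (state onH _ _ _ _ _ _ _ follows _) _ with follows refl
    ... | ()
    respond-other (state onO c⁺ c⁻ a b _ G⁺ G⁻ _ _) μ =
      continue (inO (shadow μ c⁺) (shadow μ c⁻) a b (gap-shadow μ G⁺) (gap-shadow μ G⁻))
        (slide-step O (shadow-slide μ c⁺)) (slide-step O (shadow-slide μ c⁻)) (+-monoʳ-≤ (a + b) z≤n)

    respond-toO : ∀ {x} (p : State (H , x)) → Outcome p (O , x) _≤_
    respond-toO (state onH c⁺ c⁻ a b _ G⁺ G⁻ _ _) =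
      continue (inO c⁺ c⁻ a b G⁺ G⁻) (across H c⁺) (across H c⁻) (+-monoʳ-≤ (a + b) z≤n)
    respond-toO (state onO c⁺ c⁻ a b _ G⁺ G⁻ _ _) =
      continue (inO c⁺ c⁻ a b G⁺ G⁻) stay stay (+-monoʳ-≤ (a + b) z≤n)

    respond-toH : ∀ {x} (p : State (O , x)) → Outcome p (H , x) _≤_
    respond-toH (state onH _ _ _ _ _ _ _ follows _) with follows refl
    ... | ()
    respond-toH (state onO c⁺ c⁻ a b _ G⁺ G⁻ _ _) =
      continue (inH c⁺ c⁻ a b G⁺ G⁻) (across⁻¹ H c⁺) (across⁻¹ H c⁻) (+-monoʳ-≤ (a + b) z≤n)

  module Strategy (connected : Connected Adj) (idKJ : Identity 1 k j) where

    idJK : Identity 1 j k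
    idJK = Bézout.Identity.sym idKJ

    module P = Guard false
    module Q = Guard true

    W : Vec V 5 → V → Set
    W cs r = Win Adj (lookup cs) r

    Guarded : ∀ {r} → P.State r → Q.State r → V → Vec V 5
    Guarded p q e = five (P.cop⁺ p) (P.cop⁻ p) (Q.cop⁺ q) (Q.cop⁻ q) e

    guards : ∀ {r r' _⊏_ _⊏′_} {p : P.State r} {q : Q.State r} {e e'} →
             P.Outcome p r' _⊏_ → Q.Outcome q r' _⊏′_ → Step Adj e e' →
             (∀ p' q' → P.measure p' ⊏ P.measure p → Q.measure q' ⊏′ Q.measure q →
               W (Guarded p' q' e') r') →
             Respond (Guarded p q e) r'
    guards (P.capture⁺ s) _ _ _ = catch (# 0) s
    guards (P.capture⁻ s) _ _ _ = catch (# 1) s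
    guards (P.continue _ _ _ _) (Q.capture⁺ s) _ _ = catch (# 2) s
    guards (P.continue _ _ _ _) (Q.capture⁻ s) _ _ = catch (# 3) s
    guards (P.continue p' s⁺ s⁻ ⊏p) (Q.continue q' t⁺ t⁻ ⊏q) se next =
      move5 s⁺ s⁻ t⁺ t⁻ se (next p' q' ⊏p ⊏q)

    -- The fifth cop walks towards vertex a_x of the robber's index x while he crosses spokes;
    -- any other move shrinks the guards' measure and gives him a fresh path.
    endgame : ∀ F {r} (p : P.State r) (q : Q.State r) {e} → Star Adj e (true , proj₂ r) →
              P.measure p + Q.measure q < F → W (Guarded p q e) r
    endgame-move : ∀ F {r r'} (p : P.State r) (q : Q.State r) {e} → Star Adj e (true , proj₂ r) →
                   P.measure p + Q.measure q < F → Move r r' → Respond (Guarded p q e) r'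

    endgame F p q path bound = Win-respond λ _ s → endgame-move F p q path bound (decode s)

    endgame-move zero _ _ _ () _
    endgame-move (suc F) p q _ bound (slide {true} μ) =
      guards (P.respond-other p μ) (Q.respond-own q μ) stay λ p' q' ≤p <q →
        endgame F p' q' (connected _ _) (<-≤-trans (+-mono-≤-< ≤p <q) (s≤s⁻¹ bound))
    endgame-move (suc F) p q _ bound (slide {false} μ) =
      guards (P.respond-own p μ) (Q.respond-other q μ) stay λ p' q' <p ≤q →
        endgame F p' q' (connected _ _) (<-≤-trans (+-mono-<-≤ <p ≤q) (s≤s⁻¹ bound))
    endgame-move F _ _ ε _ (cross {true} {x}) = catch (# 4) (across true x)
    endgame-move F p q (edge ◅ path) bound (cross {true}) =
      guards (P.respond-toH p) (Q.respond-toO q) (inj₂ edge) λ p' q' ≤p ≤q →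
        endgame F p' q' path (≤-<-trans (+-mono-≤ ≤p ≤q) bound)
    endgame-move F _ _ ε _ (cross {false}) = catch (# 4) stay
    endgame-move F p q (edge ◅ path) bound (cross {false}) =
      guards (P.respond-toO p) (Q.respond-toH q) (inj₂ edge) λ p' q' ≤p ≤q →
        endgame F p' q' path (≤-<-trans (+-mono-≤ ≤p ≤q) bound)

    endgame-from : ∀ {r} (p : P.State r) (y : Fin n) a → toℕ y + a * j ≋ toℕ (proj₂ r) → ∀ {e} →
                   W (five (P.cop⁺ p) (P.cop⁻ p) (false , y) (false , y) e) r
    endgame-from {r} p y a eq {e} =
      endgame (suc _) p (Q.enter y a eq) (connected e (true , proj₂ r)) ≤-refl

    Hunting : ∀ {r} → P.State r → Fin n → V → Vec V 5
    Hunting p y e = five (P.cop⁺ p) (P.cop⁻ p) (false , y) (false , y) e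

    P-responds : ∀ {r r' _⊏_} {p : P.State r} {u v e} → P.Outcome p r' _⊏_ →
                 (∀ p' → Step Adj (P.cop⁺ p) (P.cop⁺ p') → Step Adj (P.cop⁻ p) (P.cop⁻ p') →
                   P.measure p' ⊏ P.measure p → Respond (five (P.cop⁺ p) (P.cop⁻ p) u v e) r') →
                 Respond (five (P.cop⁺ p) (P.cop⁻ p) u v e) r'
    P-responds (P.capture⁺ s) _ = catch (# 0) s
    P-responds (P.capture⁻ s) _ = catch (# 1) s
    P-responds (P.continue p' s⁺ s⁻ ⊏p) next = next p' s⁺ s⁻ ⊏p

    -- The pair at b_y walks along layer b until it reaches the robber's k-coordinate.
    hunt : ∀ F {r} (p : P.State r) (y : Fin n) e a → Gap k (toℕ y) (suc e) (a * j) (toℕ (proj₂ r)) →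
           ∀ {E} → P.measure p + suc e < F → W (Hunting p y E) r
    hunt-move : ∀ F {r r'} (p : P.State r) (y : Fin n) e a →
                Gap k (toℕ y) (suc e) (a * j) (toℕ (proj₂ r)) → ∀ {E} → P.measure p + suc e < F →
                Move r r' → Respond (Hunting p y E) r'
    pursue : ∀ F {r'} (p' : P.State r') {u v E} → Step Adj u (P.cop⁺ p') → Step Adj v (P.cop⁻ p') →
             (y : Fin n) (t a : ℕ) → Gap k (toℕ y) t (a * j) (toℕ (proj₂ r')) →
             P.measure p' + pred t < F →
             Respond (five u v (false , y) (false , y) E) r'

    hunt F p y e a G bound = Win-respond λ _ s → hunt-move F p y e a G bound (decode s)

    hunt-move zero _ _ _ _ _ () _
    hunt-move (suc F) p y e a G bound (slide {false} μ) =
      P-responds (P.respond-own p μ) λ p' s⁺ s⁻ <p →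
        pursue F p' s⁺ s⁻ y (after μ e) a (gap-slide μ G)
          (<-≤-trans (+-mono-<-≤ <p (pred-mono-≤ (after≤ μ e))) (s≤s⁻¹ bound))
    hunt-move (suc F) p y e a G bound (slide {true} μ) with gap-drift {a = a} μ G
    ... | a' , G' = P-responds (P.respond-other p μ) λ p' s⁺ s⁻ ≤p →
      pursue F p' s⁺ s⁻ y (suc e) a' G' (<-≤-trans (+-mono-≤-< ≤p (n<1+n e)) (s≤s⁻¹ bound))
    hunt-move (suc F) p y e a G bound (cross {true}) = P-responds (P.respond-toH p) λ p' s⁺ s⁻ ≤p →
      pursue F p' s⁺ s⁻ y (suc e) a G (<-≤-trans (+-mono-≤-< ≤p (n<1+n e)) (s≤s⁻¹ bound))
    hunt-move (suc F) p y e a G bound (cross {false}) = P-responds (P.respond-toO p) λ p' s⁺ s⁻ ≤p →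
      pursue F p' s⁺ s⁻ y (suc e) a G (<-≤-trans (+-mono-≤-< ≤p (n<1+n e)) (s≤s⁻¹ bound))

    pursue F p' s⁺ s⁻ y zero a G _ = move5 s⁺ s⁻ stay stay stay (endgame-from p' y a (gap-arrived G))
    pursue F p' s⁺ s⁻ y (suc zero) a G _ =
      move5 s⁺ s⁻ (forward false y) (forward false y) stay
        (endgame-from p' (advance y k) a (gap-arrived (gap-advance G)))
    pursue F p' s⁺ s⁻ y (suc (suc e)) a G bound =
      move5 s⁺ s⁻ (forward false y) (forward false y) stay
        (hunt F p' (advance y k) e a (gap-advance G) bound)

    hunt-from : ∀ {r} (c : Fin n) a → toℕ c + a * k ≋ toℕ (proj₂ r) → (y : Fin n) → ∀ {E} →
                W (five (true , c) (true , c) (false , y) (false , y) E) r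
    hunt-from {r} c a eq y with bezout-gap idJK (toℕ y) (toℕ (proj₂ r))
    ... | e , a' , G = hunt (suc _) (P.enter c a eq) y (m + e) a' (gap-wrap G) ≤-refl

    Paired : Fin n → Fin n → V → Vec V 5
    Paired cx cy E = five (true , cx) (true , cx) (true , cy) (true , cy) E

    -- Two co-located pairs close in on the robber's j-coordinate from both sides.
    squeeze : ∀ F {r} cx cy ex ey ax ay → Gap j (toℕ cx) (suc ex) (ax * k) (toℕ (proj₂ r)) →
              Gap (neg j) (toℕ cy) (suc ey) (ay * k) (toℕ (proj₂ r)) → ex + ey < F → ∀ {E} →
              W (Paired cx cy E) r
    squeeze-move : ∀ F {r r'} cx cy ex ey ax ay → Gap j (toℕ cx) (suc ex) (ax * k) (toℕ (proj₂ r)) →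
                   Gap (neg j) (toℕ cy) (suc ey) (ay * k) (toℕ (proj₂ r)) → ex + ey < F → ∀ {E} →
                   Move r r' → Respond (Paired cx cy E) r'
    converge : ∀ F {r'} cx cy {tX tY ex ey} ax ay → Gap j (toℕ cx) tX (ax * k) (toℕ (proj₂ r')) →
               Gap (neg j) (toℕ cy) tY (ay * k) (toℕ (proj₂ r')) →
               tX + tY ≡ suc ex + suc ey → ex + ey < F →
               ∀ {E} → Respond (Paired cx cy E) r'

    squeeze F cx cy ex ey ax ay GX GY bound =
      Win-respond λ _ s → squeeze-move F cx cy ex ey ax ay GX GY bound (decode s)

    squeeze-move F cx cy ex ey ax ay GX GY bound (slide {true} μ) =
      converge F cx cy ax ay (gap-slide μ GX) (gap-slide (Slide-flip μ) GY) (after-flip μ ex ey) bound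
    squeeze-move F cx cy ex ey ax ay GX GY bound (slide {false} μ)
      with gap-drift {a = ax} μ GX | gap-drift {a = ay} μ GY
    ... | ax' , GX' | ay' , GY' = converge F cx cy ax' ay' GX' GY' refl bound
    squeeze-move F cx cy ex ey ax ay GX GY bound cross = converge F cx cy ax ay GX GY refl bound

    converge F cx cy {zero} ax ay GX GY _ _ =
      move5 stay stay (across true cy) (across true cy) stay (hunt-from cx ax (gap-arrived GX) cy)
    converge F cx cy {suc zero} ax ay GX GY _ _ =
      move5 (forward true cx) (forward true cx) (across true cy) (across true cy) stay
        (hunt-from (advance cx j) ax (gap-arrived (gap-advance GX)) cy)
    converge F cx cy {suc (suc _)} {zero} ax ay GX GY _ _ =
      move5 (across true cx) (across true cx) stay stay stay
        (swap-pairs (hunt-from cy ay (gap-arrived GY) cx))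
    converge F cx cy {suc (suc _)} {suc zero} ax ay GX GY _ _ =
      move5 (across true cx) (across true cx) (backward true cy) (backward true cy) stay
        (swap-pairs (hunt-from (advance cy (neg j)) ay (gap-arrived (gap-advance GY)) cx))
    converge zero _ _ {suc (suc _)} {suc (suc _)} _ _ _ _ _ ()
    converge (suc F) cx cy {suc (suc ex)} {suc (suc ey)} ax ay GX GY sum bound =
      move5 (forward true cx) (forward true cx) (backward true cy) (backward true cy) stay
        (squeeze F (advance cx j) (advance cy (neg j)) ex ey ax ay (gap-advance GX) (gap-advance GY)
          (<-≤-trans (squeeze-< sum) (s≤s⁻¹ bound)))

    cops-win : CopsWin Adj 5
    cops-win = lookup (five a₀ a₀ a₀ a₀ a₀) , λ r →
      lookup (five a₀ a₀ a₀ a₀ a₀) , (λ _ → stay) , start r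
      where
      a₀ : V
      a₀ = true , Fin.zero
      start : ∀ r → W (five a₀ a₀ a₀ a₀ a₀) r
      start r with bezout-gap idKJ 0 (toℕ (proj₂ r))
      ... | e , a , G =
        squeeze (suc _) Fin.zero Fin.zero (m + e) (m + neg e) a a (gap-wrap G) (gap-wrap (gap-reverse G)) ≤-refl

mainTheorem4 : (n k j : ℕ) → 5 ≤ n → 0 < j → 2 * j < n → 0 < k → 2 * k < n →
    gcd k j ≡ 1 → Connected (IAdj n k j) → CopNumber≤ (IAdj n k j) 5
mainTheorem4 (suc m) k j _ _ _ _ _ gcd≡1 connected =
  5 , ≤-refl , IGraph.Strategy.cops-win m k j connected idKJ
  where
  idKJ : Identity 1 k j
  idKJ = subst (λ d → Identity d k j) gcd≡1 (Bézout.identity (gcd-GCD k j))
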